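{- Let $n\ge1$ and $d\ge1$. If there is a 1-cycle consisting of exactly $d$ classes, then $d\mid n$.
   Context: Let $\sigma\in S_n$ be $\sigma(i)=i+1$ for $i<n$, $\sigma(n)=1$. For $\pi\in S_n$ let $\mathrm{inc}(\pi)=\{\sigma^k\circ\pi:0\le k\le n-1\}$; these sets are the classes of an equivalence relation on $S_n$. The map $f(\mathrm{inc}(\pi))=\mathrm{inc}(\pi\circ\sigma)$ is a well-defined permutation of the set of classes (in the paper's transition graph $H_n$ on the classes, these are exactly the weight-1 transitions). A 1-cycle is an orbit of $f$ (a class fixed by $f$ is a 1-cycle of length 1); its length is the number of classes in it. -}

module Defs where

open import Data.Nat using (ℕ; zero; suc; _+_; _<_; _%_)
open import Data.Nat.DivMod using (m%n<n)
open import Data.Fin using (Fin; toℕ; fromℕ<)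
open import Data.Fin.Permutation using (Permutation′; _⟨$⟩ʳ_)
open import Data.Product using (∃-syntax; _×_)
open import Relation.Binary.PropositionalEquality using (_≡_)
open import Relation.Nullary using (¬_)

iter : {A : Set} → (A → A) → ℕ → A → A
iter f zero    x = x
iter f (suc k) x = f (iter f k x)

-- σ on {1..n} (n = suc m), written on Fin (suc m) = {0..m}: i ↦ i+1 mod n
σ : {m : ℕ} → Fin (suc m) → Fin (suc m)
σ {m} i = fromℕ< (m%n<n (toℕ i + 1) (suc m))

Perm→Fun : {n : ℕ} → Permutation′ n → Fin n → Fin n
Perm→Fun π i = π ⟨$⟩ʳ i

-- ρ ∈ inc(π), i.e. ρ = σ^k ∘ π for some 0 ≤ k ≤ n-1.
-- Classes are represented by representatives; two representatives
-- denote the same class iff they are related by SameClass.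
SameClass : {m : ℕ} → (Fin (suc m) → Fin (suc m)) → (Fin (suc m) → Fin (suc m)) → Set
SameClass {m} π ρ = ∃[ k ] (k < suc m × (∀ i → ρ i ≡ iter σ k (π i)))

-- f(inc(π)) = inc(π ∘ σ), on representatives
fRep : {m : ℕ} → (Fin (suc m) → Fin (suc m)) → (Fin (suc m) → Fin (suc m))
fRep π i = π (σ i)

OneCycleOfLength : {m : ℕ} → Permutation′ (suc m) → ℕ → Set
OneCycleOfLength π d =
  (0 < d)
  × SameClass (Perm→Fun π) (iter fRep d (Perm→Fun π))
  × (∀ j → 0 < j → j < d → ¬ SameClass (Perm→Fun π) (iter fRep j (Perm→Fun π)))

-- If π ∘ σ^d = σ^k ∘ π, then iterating gives π ∘ σ^(qd) = σ^(qk) ∘ π. Writing n = qd + r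
-- and using σ^n = id, we get π ∘ σ^r = σ^(−qk) ∘ π = σ^(m·qk) ∘ π, i.e. f^r fixes the class of π.
-- Minimality of the cycle length d forces r = 0, so d ∣ n.
module Submission where

open import Defs
open import Data.Nat using (ℕ; suc; _≤_)
open import Data.Nat.Divisibility using (_∣_)
open import Data.Fin.Permutation using (Permutation′)

open import Data.Nat using (zero; _+_; _*_; _%_; _/_; _<_; NonZero; z<s)
open import Data.Nat.Properties using (+-comm; +-assoc; +-identityʳ; *-comm)
open import Data.Nat.DivMod using (m≡m%n+[m/n]*n; %-distribˡ-+; m%n%n≡m%n; m*n%n≡0; m%n<n; m<n⇒m%n≡m; n%n≡0)
open import Data.Nat.Divisibility using (m%n≡0⇒n∣m)
open import Data.Fin using (Fin; toℕ)
open import Data.Fin.Properties using (toℕ-injective; toℕ-fromℕ<; toℕ<n)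
open import Data.Product using (_,_)
open import Function using (_∘_)
open import Relation.Binary.PropositionalEquality
open import Relation.Nullary using (contradiction)

iter-+ : {A : Set} (f : A → A) (a b : ℕ) (x : A) → iter f (a + b) x ≡ iter f a (iter f b x)
iter-+ f zero    b x = refl
iter-+ f (suc a) b x = cong f (iter-+ f a b x)

iter-sucʳ : {A : Set} (f : A → A) (j : ℕ) (x : A) → iter f (suc j) x ≡ iter f j (f x)
iter-sucʳ f zero    x = refl
iter-sucʳ f (suc j) x = cong f (iter-sucʳ f j x)

iter-precompose : {A B : Set} (g : A → A) (j : ℕ) (P : A → B) (x : A) →
                  iter (λ Q → Q ∘ g) j P x ≡ P (iter g j x)
iter-precompose g zero    P x = refl
iter-precompose g (suc j) P x =
  trans (iter-precompose g j P (g x)) (cong P (sym (iter-sucʳ g j x)))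

iter-intertwine-* : {A B : Set} {g : A → A} {h : B → B} {P : A → B} {d k : ℕ} →
                    (∀ x → P (iter g d x) ≡ iter h k (P x)) →
                    ∀ t x → P (iter g (t * d) x) ≡ iter h (t * k) (P x)
iter-intertwine-* intertwine zero x = refl
iter-intertwine-* {g = g} {h} {P} {d} {k} intertwine (suc t) x = begin
  P (iter g (d + t * d) x)         ≡⟨ cong P (iter-+ g d (t * d) x) ⟩
  P (iter g d (iter g (t * d) x))  ≡⟨ intertwine _ ⟩
  iter h k (P (iter g (t * d) x))  ≡⟨ cong (iter h k) (iter-intertwine-* intertwine t x) ⟩
  iter h k (iter h (t * k) (P x))  ≡⟨ iter-+ h k (t * k) (P x) ⟨
  iter h (k + t * k) (P x)         ∎
  where open ≡-Reasoning

[m%n+k]%n≡[m+k]%n : ∀ m k n .{{_ : NonZero n}} → (m % n + k) % n ≡ (m + k) % n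
[m%n+k]%n≡[m+k]%n m k n = begin
  (m % n + k) % n            ≡⟨ %-distribˡ-+ (m % n) k n ⟩
  (m % n % n + k % n) % n    ≡⟨ cong (λ v → (v + k % n) % n) (m%n%n≡m%n m n) ⟩
  (m % n + k % n) % n        ≡⟨ %-distribˡ-+ m k n ⟨
  (m + k) % n                ∎
  where open ≡-Reasoning

module _ {m : ℕ} where
  private
    n = suc m

  toℕ-iter-σ : ∀ k (x : Fin n) → toℕ (iter σ k x) ≡ (toℕ x + k) % n
  toℕ-iter-σ zero    x = sym (trans (cong (_% n) (+-identityʳ (toℕ x))) (m<n⇒m%n≡m (toℕ<n x)))
  toℕ-iter-σ (suc k) x = begin
    toℕ (σ (iter σ k x))        ≡⟨ toℕ-fromℕ< _ ⟩
    (toℕ (iter σ k x) + 1) % n  ≡⟨ cong (λ v → (v + 1) % n) (toℕ-iter-σ k x) ⟩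
    ((toℕ x + k) % n + 1) % n   ≡⟨ [m%n+k]%n≡[m+k]%n (toℕ x + k) 1 n ⟩
    (toℕ x + k + 1) % n         ≡⟨ cong (_% n) (trans (+-assoc (toℕ x) k 1) (cong (toℕ x +_) (+-comm k 1))) ⟩
    (toℕ x + suc k) % n         ∎
    where open ≡-Reasoning

  iter-σ-cong-% : ∀ k l → k % n ≡ l % n → (x : Fin n) → iter σ k x ≡ iter σ l x
  iter-σ-cong-% k l k≡l x = toℕ-injective (begin
    toℕ (iter σ k x)           ≡⟨ toℕ-iter-σ k x ⟩
    (toℕ x + k) % n            ≡⟨ %-distribˡ-+ (toℕ x) k n ⟩
    (toℕ x % n + k % n) % n    ≡⟨ cong (λ v → (toℕ x % n + v) % n) k≡l ⟩
    (toℕ x % n + l % n) % n    ≡⟨ %-distribˡ-+ (toℕ x) l n ⟨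
    (toℕ x + l) % n            ≡⟨ toℕ-iter-σ l x ⟨
    toℕ (iter σ l x)           ∎)
    where open ≡-Reasoning

  sameClass-iterate-% : ∀ (P : Fin n → Fin n) d .{{_ : NonZero d}} →
                        SameClass P (iter fRep d P) → SameClass P (iter fRep (n % d) P)
  sameClass-iterate-% P d (k , _ , P∘σᵈ≡σᵏ∘P) = c % n , m%n<n c n , P∘σʳ≡σᶜ∘P
    where
      q = n / d
      r = n % d
      x = q * k
      c = m * x

      intertwine : ∀ i → P (iter σ d i) ≡ iter σ k (P i)
      intertwine i = trans (sym (iter-precompose σ d P i)) (P∘σᵈ≡σᵏ∘P i)

      n≡qd+r : n ≡ q * d + r
      n≡qd+r = trans (m≡m%n+[m/n]*n n d) (+-comm r (q * d))

      -- c + x = n x, so σ^c undoes σ^x.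
      [c+x]%n≡0 : (c + x) % n ≡ 0
      [c+x]%n≡0 = trans (cong (_% n) (trans (+-comm c x) (*-comm n x))) (m*n%n≡0 x n)

      P∘σʳ≡σᶜ∘P : ∀ i → iter fRep r P i ≡ iter σ (c % n) (P i)
      P∘σʳ≡σᶜ∘P i = begin
        iter fRep r P i                            ≡⟨ iter-precompose σ r P i ⟩
        P (iter σ r i)                             ≡⟨ iter-σ-cong-% (c + x) 0 [c+x]%n≡0 _ ⟨
        iter σ (c + x) (P (iter σ r i))            ≡⟨ iter-+ σ c x _ ⟩
        iter σ c (iter σ x (P (iter σ r i)))       ≡⟨ cong (iter σ c) (iter-intertwine-* intertwine q _) ⟨
        iter σ c (P (iter σ (q * d) (iter σ r i))) ≡⟨ cong (iter σ c ∘ P) (iter-+ σ (q * d) r i) ⟨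
        iter σ c (P (iter σ (q * d + r) i))        ≡⟨ cong (λ v → iter σ c (P (iter σ v i))) n≡qd+r ⟨
        iter σ c (P (iter σ n i))                  ≡⟨ cong (iter σ c ∘ P) (iter-σ-cong-% n 0 (n%n≡0 n) i) ⟩
        iter σ c (P i)                             ≡⟨ iter-σ-cong-% c (c % n) (sym (m%n%n≡m%n c n)) (P i) ⟩
        iter σ (c % n) (P i)                       ∎
        where open ≡-Reasoning

lemma3 : (m d : ℕ) → 1 ≤ d → (π : Permutation′ (suc m)) → OneCycleOfLength π d → d ∣ suc m
lemma3 m (suc d) _ π (_ , cycle , minimal) with suc m % suc d in r≡
... | zero  = m%n≡0⇒n∣m (suc m) (suc d) r≡
... | suc r = contradiction
  (subst (λ j → SameClass (Perm→Fun π) (iter fRep j (Perm→Fun π))) r≡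
         (sameClass-iterate-% (Perm→Fun π) (suc d) cycle))
  (minimal (suc r) z<s (subst (_< suc d) r≡ (m%n<n (suc m) (suc d))))
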